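{- If $G=(G,x)$ and $T=(T,y)$ are pointed graphs with $T$ finite, then there are isomorphisms of pointed graphs $(G^I)^T\cong(G^T)^I$ and $(\Omega G)^T\cong\Omega(G^T)$.
   Context: A graph has vertex set $V(G)$ and symmetric edge set $E(G)$ (loops allowed); $v\sim w$ means adjacency. A pointed graph $(G,x)$ has a distinguished looped vertex $x$. Pointed internal hom $H^G$ for pointed $(G,x),(H,y)$: vertices all set maps $f:V(G)\to V(H)$ with $f(x)=y$; $f\sim g$ iff $f(v)\sim g(v')$ for all $v\sim v'$ in $G$; basepoint the constant map at $y$. Path graph $G^I$: its vertices are the functions $f:\mathbb{N}=\{0,1,2,\dots\}\to V(G)$ with $f(0)=x$ that are eventually constant (there is $N_f$ with $f(i)=f(j)$ for all $i,j\ge N_f$); $f\sim g$ iff $f(i)\sim g(j)$ for all $i,j$ with $|i-j|\le1$; it is pointed by the constant path at $x$. (Equivalently, $G^I$ is the union of the graphs $G^{I_n}$, where $I_n$ is the graph on $\{0,\dots,n\}$ with $i\sim j$ iff $|i-j|\le1$, pointed by $0$.) The loop space graph $\Omega G$ is the induced subgraph of $G^I$ on those $f$ whose eventual constant value is $x$, pointed by the constant path at $x$. -}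

module Defs where

open import Level using (0ℓ)
open import Data.Nat using (ℕ; zero; suc; _≤_; z≤n)
open import Data.Fin using (Fin)
open import Data.Product using (Σ; _×_; _,_; proj₁; proj₂)
open import Relation.Binary using (Setoid; IsEquivalence)
import Relation.Binary.PropositionalEquality as ≡
open import Function.Bundles using (Inverse)

-- A graph: a vertex set (constructively a setoid: a type with an equality
-- relation) and a symmetric adjacency relation respecting that equality.
-- Loops are allowed (nothing forbids v ~ v).
record Graph : Set₁ where
  field
    V        : Set
    _≈_      : V → V → Set
    isEquiv  : IsEquivalence _≈_
    _~_      : V → V → Set
    ~-sym    : ∀ {v w} → v ~ w → w ~ v
    ~-resp   : ∀ {v v' w w'} → v ≈ v' → w ≈ w' → v ~ w → v' ~ w'

  setoid : Setoid 0ℓ 0ℓ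
  setoid = record { isEquivalence = isEquiv }

  open IsEquivalence isEquiv public renaming (refl to ≈-refl; sym to ≈-sym; trans to ≈-trans)

record PGraph : Set₁ where
  field
    graph   : Graph
    pt      : Graph.V graph
    pt-loop : Graph._~_ graph pt pt
  open Graph graph public

open PGraph

-- Pointed internal hom  H^G  (written Hom G H): basepoint-preserving maps
-- V(G) → V(H) (respecting vertex equality); f ~ g iff f v ~ g v' for all v ~ v'.
Hom : PGraph → PGraph → PGraph
Hom G H = record
  { graph = record
    { V       = Σ (V G → V H) λ f →
                  (∀ {v w} → _≈_ G v w → _≈_ H (f v) (f w)) × _≈_ H (f (pt G)) (pt H)
    ; _≈_     = λ f g → ∀ v → _≈_ H (proj₁ f v) (proj₁ g v)
    ; isEquiv = record
      { refl  = λ v → ≈-refl H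
      ; sym   = λ p v → ≈-sym H (p v)
      ; trans = λ p q v → ≈-trans H (p v) (q v) }
    ; _~_     = λ f g → ∀ v v' → _~_ G v v' → _~_ H (proj₁ f v) (proj₁ g v')
    ; ~-sym   = λ p v v' e → ~-sym H (p v' v (~-sym G e))
    ; ~-resp  = λ p q r v v' e → ~-resp H (p v) (q v') (r v v' e)
    }
  ; pt      = (λ _ → pt H) , (λ _ → ≈-refl H) , ≈-refl H
  ; pt-loop = λ v v' e → pt-loop H
  }

EventuallyConst : (G : Graph) → (ℕ → Graph.V G) → Set
EventuallyConst G f = Σ ℕ λ N → ∀ i j → N ≤ i → N ≤ j → Graph._≈_ G (f i) (f j)

Near : ℕ → ℕ → Set
Near i j = (i ≤ suc j) × (j ≤ suc i)

PathG : PGraph → PGraph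
PathG G = record
  { graph = record
    { V       = Σ (ℕ → V G) λ f → _≈_ G (f 0) (pt G) × EventuallyConst (graph G) f
    ; _≈_     = λ f g → ∀ i → _≈_ G (proj₁ f i) (proj₁ g i)
    ; isEquiv = record
      { refl  = λ i → ≈-refl G
      ; sym   = λ p i → ≈-sym G (p i)
      ; trans = λ p q i → ≈-trans G (p i) (q i) }
    ; _~_     = λ f g → ∀ i j → Near i j → _~_ G (proj₁ f i) (proj₁ g j)
    ; ~-sym   = λ p i j n → ~-sym G (p j i (proj₂ n , proj₁ n))
    ; ~-resp  = λ p q r i j n → ~-resp G (p i) (q j) (r i j n)
    }
  ; pt      = (λ _ → pt G) , ≈-refl G , (0 , λ _ _ _ _ → ≈-refl G)
  ; pt-loop = λ _ _ _ → pt-loop G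
  }

Induced : (G : PGraph) (P : V G → Set) → P (pt G) → PGraph
Induced G P p0 = record
  { graph = record
    { V       = Σ (V G) P
    ; _≈_     = λ a b → _≈_ G (proj₁ a) (proj₁ b)
    ; isEquiv = record
      { refl  = ≈-refl G
      ; sym   = ≈-sym G
      ; trans = ≈-trans G }
    ; _~_     = λ a b → _~_ G (proj₁ a) (proj₁ b)
    ; ~-sym   = ~-sym G
    ; ~-resp  = ~-resp G
    }
  ; pt      = pt G , p0
  ; pt-loop = pt-loop G
  }

Ω : PGraph → PGraph
Ω G = Induced (PathG G)
        (λ f → Σ ℕ λ N → ∀ i → N ≤ i → _≈_ G (proj₁ f i) (pt G))
        (0 , λ _ _ → ≈-refl G)

Finite : PGraph → Set
Finite T = Σ ℕ λ n → Inverse (≡.setoid (Fin n)) (setoid T)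

record _≅_ (A B : PGraph) : Set where
  field
    inverse : Inverse (setoid A) (setoid B)
  open Inverse inverse public
  field
    to-~   : ∀ {v w} → _~_ A v w → _~_ B (to v) (to w)
    from-~ : ∀ {v w} → _~_ B v w → _~_ A (from v) (from w)
    to-pt  : _≈_ B (to (pt A)) (pt B)

module Submission where

-- Both isomorphisms swap the two arguments of a map T → (ℕ → G), i.e. they are
-- the exponential law (G^I)^T ≅ G^(T×I) ≅ (G^T)^I.  Adjacency on both sides says
-- the same thing, so the only point is that the eventual-constancy conditions
-- match: a family of paths indexed by T that is eventually constant at each t is
-- eventually constant uniformly in t, because T is finite and the thresholds
-- for the finitely many t have a common upper bound.

open import Level using (0ℓ)
open import Data.Product using (Σ; _×_; _,_; proj₁; proj₂; map₂)
open import Data.Nat using (ℕ; zero; suc; _≤_; _⊔_)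
open import Data.Nat.Properties using (≤-trans; m≤m⊔n; m≤n⊔m)
open import Data.Fin using (Fin)
import Data.Fin as Fin
open import Relation.Binary using (Setoid)
import Relation.Binary.PropositionalEquality as ≡
open import Function.Bundles using (Inverse)
open import Defs

Fin-bounded : ∀ n (g : Fin n → ℕ) → Σ ℕ λ M → ∀ k → g k ≤ M
Fin-bounded zero    g = 0 , λ ()
Fin-bounded (suc n) g with Fin-bounded n (λ k → g (Fin.suc k))
... | M , g≤M = g Fin.zero ⊔ M , λ where
  Fin.zero    → m≤m⊔n _ _
  (Fin.suc k) → ≤-trans (g≤M k) (m≤n⊔m _ _)

-- Each t only needs to come with some threshold; the choice need not respect
-- the setoid equality, which is why Q must be invariant under it.
common-threshold : ∀ {S : Setoid 0ℓ 0ℓ} {n} → Inverse (≡.setoid (Fin n)) S →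
  (Q : Setoid.Carrier S → ℕ → Set) →
  (∀ {s t N M} → Setoid._≈_ S s t → N ≤ M → Q s N → Q t M) →
  (∀ t → Σ ℕ (Q t)) → Σ ℕ λ M → ∀ t → Q t M
common-threshold {n = n} enum Q Q-resp threshold =
  map₂ (λ ≤M t → Q-resp (strictlyInverseˡ t) (≤M (from t)) (proj₂ (threshold (to (from t)))))
       (Fin-bounded n (λ k → proj₁ (threshold (to k))))
  where open Inverse enum

module _ (G : Graph) where
  open Graph G

  StableFrom : (ℕ → V) → ℕ → Set
  StableFrom f N = ∀ i j → N ≤ i → N ≤ j → f i ≈ f j

  ReachesFrom : (ℕ → V) → V → ℕ → Set
  ReachesFrom f y N = ∀ i → N ≤ i → f i ≈ y

  StableFrom-resp : ∀ {f g N M} → (∀ i → f i ≈ g i) → N ≤ M →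
                    StableFrom f N → StableFrom g M
  StableFrom-resp f≈g N≤M stable i j M≤i M≤j =
    ≈-trans (≈-sym (f≈g i)) (≈-trans (stable i j (≤-trans N≤M M≤i) (≤-trans N≤M M≤j)) (f≈g j))

  ReachesFrom-resp : ∀ {f g y N M} → (∀ i → f i ≈ g i) → N ≤ M →
                     ReachesFrom f y N → ReachesFrom g y M
  ReachesFrom-resp f≈g N≤M reaches i M≤i = ≈-trans (≈-sym (f≈g i)) (reaches i (≤-trans N≤M M≤i))

open PGraph

module _ (G T : PGraph) (finite : Finite T) where
  private
    enum : Inverse (≡.setoid (Fin (proj₁ finite))) (setoid T)
    enum = proj₂ finite

  transpose : V (Hom T (PathG G)) → V (PathG (Hom T G))
  transpose (f , f-cong , f-pt) =
    (λ i → (λ t → proj₁ (f t) i) , (λ s≈t → f-cong s≈t i) , f-pt i) ,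
    (λ t → proj₁ (proj₂ (f t))) ,
    map₂ (λ stable i j M≤i M≤j t → stable t i j M≤i M≤j)
      (common-threshold enum (λ t → StableFrom (graph G) (proj₁ (f t)))
        (λ s≈t → StableFrom-resp (graph G) (f-cong s≈t))
        (λ t → proj₂ (proj₂ (f t))))

  untranspose : V (PathG (Hom T G)) → V (Hom T (PathG G))
  untranspose (p , p-start , N , p-stable) =
    (λ t → (λ i → proj₁ (p i) t) , p-start t , N , λ i j N≤i N≤j → p-stable i j N≤i N≤j t) ,
    (λ s≈t i → proj₁ (proj₂ (p i)) s≈t) ,
    (λ i → proj₂ (proj₂ (p i)))

  Hom-PathG-≅ : Hom T (PathG G) ≅ PathG (Hom T G)
  Hom-PathG-≅ = record
    { inverse = record
      { to        = transpose
      ; from      = untranspose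
      ; to-cong   = λ f≈g i t → f≈g t i
      ; from-cong = λ p≈q t i → p≈q i t
      ; inverse   = (λ p≈q i t → p≈q t i) , (λ f≈g t i → f≈g i t)
      }
    ; to-~   = λ f~g i j near t t' t~t' → f~g t t' t~t' i j near
    ; from-~ = λ p~q t t' t~t' i j near → p~q i j near t t' t~t'
    ; to-pt  = λ i t → ≈-refl G
    }

  transposeΩ : V (Hom T (Ω G)) → V (Ω (Hom T G))
  transposeΩ (f , f-cong , f-pt) =
    transpose ((λ t → proj₁ (f t)) , f-cong , f-pt) ,
    map₂ (λ reaches i M≤i t → reaches t i M≤i)
      (common-threshold enum (λ t → ReachesFrom (graph G) (proj₁ (proj₁ (f t))) (pt G))
        (λ s≈t → ReachesFrom-resp (graph G) (f-cong s≈t))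
        (λ t → proj₂ (f t)))

  untransposeΩ : V (Ω (Hom T G)) → V (Hom T (Ω G))
  untransposeΩ (p , N , p-reaches) =
    (λ t → proj₁ (untranspose p) t , N , λ i N≤i → p-reaches i N≤i t) ,
    proj₂ (untranspose p)

  Hom-Ω-≅ : Hom T (Ω G) ≅ Ω (Hom T G)
  Hom-Ω-≅ = record
    { inverse = record
      { to        = transposeΩ
      ; from      = untransposeΩ
      ; to-cong   = λ f≈g i t → f≈g t i
      ; from-cong = λ p≈q t i → p≈q i t
      ; inverse   = (λ p≈q i t → p≈q t i) , (λ f≈g t i → f≈g i t)
      }
    ; to-~   = λ f~g i j near t t' t~t' → f~g t t' t~t' i j near
    ; from-~ = λ p~q t t' t~t' i j near → p~q i j near t t' t~t'
    ; to-pt  = λ i t → ≈-refl G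
    }

mainTheorem5 : (G T : PGraph) → Finite T →
    (Hom T (PathG G) ≅ PathG (Hom T G)) × (Hom T (Ω G) ≅ Ω (Hom T G))
mainTheorem5 G T finite = Hom-PathG-≅ G T finite , Hom-Ω-≅ G T finite
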